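{- The calculi $\mathsf{G4CK}$ and $\mathsf{G4WK}$ strongly terminate: for $\mathsf{S}\in\{\mathsf{G4CK},\mathsf{G4WK}\}$ there is no infinite sequence of sequents $s_0,s_1,s_2,\dots$ such that for every $i$, $s_{i+1}$ is a premise of some instance of a rule of $\mathsf{S}$ whose conclusion is $s_i$; i.e., naive backward proof search (iteratively applying rules backwards in any way) necessarily halts.
   Context: Formulas are built from a countably infinite set $\mathsf{Prop}$ of propositional variables by $\varphi ::= p \mid \bot \mid \varphi\wedge\varphi \mid \varphi\vee\varphi \mid \varphi\to\varphi \mid \Box\varphi \mid \Diamond\varphi$. For a multiset $\Gamma$, $\Box^{ -1}\Gamma=\{\varphi\mid\Box\varphi\in\Gamma\}$ and $\Diamond^{ -1}\Gamma=\{\varphi\mid\Diamond\varphi\in\Gamma\}$ (with multiplicities). A sequent is $\Gamma\Rightarrow\Delta$ with $\Gamma,\Delta$ finite multisets of formulas; $\Gamma,\varphi$ means $\Gamma\uplus\{\varphi\}$; a single formula on the right denotes a singleton. In $\mathsf{G4CK}$ succedents have exactly one element; in $\mathsf{G4WK}$ at most one. Common rules ($p\in\mathsf{Prop}$, $\Delta$ an allowed succedent): ($\bot$L) $\Gamma,\bot\Rightarrow\Delta$ (no premises); (IdP) $\Gamma,p\Rightarrow p$ (no premises); ($\wedge$L) from $\Gamma,\varphi,\psi\Rightarrow\Delta$ infer $\Gamma,\varphi\wedge\psi\Rightarrow\Delta$; ($\wedge$R) from $\Gamma\Rightarrow\varphi$, $\Gamma\Rightarrow\psi$ infer $\Gamma\Rightarrow\varphi\wedge\psi$;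 ($\vee$L) from $\Gamma,\varphi\Rightarrow\Delta$, $\Gamma,\psi\Rightarrow\Delta$ infer $\Gamma,\varphi\vee\psi\Rightarrow\Delta$; ($\vee$R$_i$) from $\Gamma\Rightarrow\varphi_i$ infer $\Gamma\Rightarrow\varphi_1\vee\varphi_2$; ($\to$R) from $\Gamma,\varphi\Rightarrow\psi$ infer $\Gamma\Rightarrow\varphi\to\psi$; ($\wedge\!\to$L) from $\Gamma,\varphi\to(\psi\to\chi)\Rightarrow\Delta$ infer $\Gamma,(\varphi\wedge\psi)\to\chi\Rightarrow\Delta$; ($\vee\!\to$L) from $\Gamma,\varphi\to\chi,\psi\to\chi\Rightarrow\Delta$ infer $\Gamma,(\varphi\vee\psi)\to\chi\Rightarrow\Delta$; ($p\!\to$L) from $\Gamma,p,\varphi\Rightarrow\Delta$ infer $\Gamma,p,p\to\varphi\Rightarrow\Delta$; ($\to\to$L) from $\Gamma,\psi\to\chi\Rightarrow\varphi\to\psi$ and $\Gamma,\chi\Rightarrow\Delta$ infer $\Gamma,(\varphi\to\psi)\to\chi\Rightarrow\Delta$; ($\Box$R) from $\Box^{ -1}\Gamma\Rightarrow\varphi$ infer $\Gamma\Rightarrow\Box\varphi$; ($\Box\!\to$L) from $\Box^{ -1}\Gamma\Rightarrow\varphi$ and $\Gamma,\psi\Rightarrow\Delta$ infer $\Gamma,\Box\varphi\to\psi\Rightarrow\Delta$; ($\Diamond\!\to$L) from $\Box^{ -1}\Gamma,\gamma\Rightarrow\varphi$ and $\Gamma,\Diamond\gamma,\psi\Rightarrow\Delta$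 infer $\Gamma,\Diamond\gamma,\Diamond\varphi\to\psi\Rightarrow\Delta$. $\mathsf{G4CK}$ additionally has ($\Diamond$L): from $\Box^{ -1}\Gamma,\varphi\Rightarrow\psi$ infer $\Gamma,\Diamond\varphi\Rightarrow\Diamond\psi$; $\mathsf{G4WK}$ instead has ($\Diamond$L$'$): from $\Box^{ -1}\Gamma,\varphi\Rightarrow\Diamond^{ -1}\Delta$ infer $\Gamma,\Diamond\varphi\Rightarrow\Delta$. -}

module Defs where

open import Data.Nat using (ℕ; suc)
import Data.Empty
open import Data.List using (List; []; _∷_)
open import Data.Maybe using (Maybe; just; nothing)
open import Data.Product using (Σ; _×_; _,_; ∃-syntax)
open import Data.List.Relation.Unary.Any using (Any)
open import Data.List.Relation.Binary.Permutation.Propositional using (_↭_)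
open import Relation.Binary.PropositionalEquality using (_≡_)

Prop : Set
Prop = ℕ

infixr 8 _∧_
infixr 7 _∨_
infixr 6 _⇒_

data Fm : Set where
  var : Prop → Fm
  ⊥   : Fm
  _∧_ : Fm → Fm → Fm
  _∨_ : Fm → Fm → Fm
  _⇒_ : Fm → Fm → Fm
  □   : Fm → Fm
  ◇   : Fm → Fm

box⁻¹ : List Fm → List Fm
box⁻¹ [] = []
box⁻¹ (□ φ ∷ Γ) = φ ∷ box⁻¹ Γ
box⁻¹ (_ ∷ Γ) = box⁻¹ Γ

-- Multisets are represented by lists; multiset equality is permutation (_↭_).
-- A sequent over succedent type S: antecedent multiset and succedent.
Seq : Set → Set
Seq S = List Fm × S

-- Equality of sequents as multiset sequents (succedents have at most one
-- element, so propositional equality is multiset equality there).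
_≈_ : {S : Set} → Seq S → Seq S → Set
(Γ , Δ) ≈ (Γ' , Δ') = (Γ ↭ Γ') × (Δ ≡ Δ')

-- Rules common to G4CK and G4WK, parametric in the succedent type S
-- (the allowed succedents) and the embedding of a single formula as a
-- singleton succedent.
data Common (S : Set) (one : Fm → S) : List (Seq S) → Seq S → Set where
  ⊥L   : ∀ Γ Δ → Common S one [] (⊥ ∷ Γ , Δ)
  IdP  : ∀ Γ p → Common S one [] (var p ∷ Γ , one (var p))
  ∧L   : ∀ Γ φ ψ Δ → Common S one ((φ ∷ ψ ∷ Γ , Δ) ∷ []) (φ ∧ ψ ∷ Γ , Δ)
  ∧R   : ∀ Γ φ ψ → Common S one ((Γ , one φ) ∷ (Γ , one ψ) ∷ []) (Γ , one (φ ∧ ψ))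
  ∨L   : ∀ Γ φ ψ Δ → Common S one ((φ ∷ Γ , Δ) ∷ (ψ ∷ Γ , Δ) ∷ []) (φ ∨ ψ ∷ Γ , Δ)
  ∨R₁  : ∀ Γ φ₁ φ₂ → Common S one ((Γ , one φ₁) ∷ []) (Γ , one (φ₁ ∨ φ₂))
  ∨R₂  : ∀ Γ φ₁ φ₂ → Common S one ((Γ , one φ₂) ∷ []) (Γ , one (φ₁ ∨ φ₂))
  ⇒R   : ∀ Γ φ ψ → Common S one ((φ ∷ Γ , one ψ) ∷ []) (Γ , one (φ ⇒ ψ))
  ∧⇒L  : ∀ Γ φ ψ χ Δ → Common S one ((φ ⇒ (ψ ⇒ χ) ∷ Γ , Δ) ∷ []) ((φ ∧ ψ) ⇒ χ ∷ Γ , Δ)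
  ∨⇒L  : ∀ Γ φ ψ χ Δ → Common S one ((φ ⇒ χ ∷ ψ ⇒ χ ∷ Γ , Δ) ∷ []) ((φ ∨ ψ) ⇒ χ ∷ Γ , Δ)
  p⇒L  : ∀ Γ p φ Δ → Common S one ((var p ∷ φ ∷ Γ , Δ) ∷ []) (var p ∷ (var p ⇒ φ) ∷ Γ , Δ)
  ⇒⇒L  : ∀ Γ φ ψ χ Δ →
         Common S one ((ψ ⇒ χ ∷ Γ , one (φ ⇒ ψ)) ∷ (χ ∷ Γ , Δ) ∷ []) ((φ ⇒ ψ) ⇒ χ ∷ Γ , Δ)
  □R   : ∀ Γ φ → Common S one ((box⁻¹ Γ , one φ) ∷ []) (Γ , one (□ φ))
  □⇒L  : ∀ Γ φ ψ Δ →
         Common S one ((box⁻¹ Γ , one φ) ∷ (ψ ∷ Γ , Δ) ∷ []) (□ φ ⇒ ψ ∷ Γ , Δ)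
  ◇⇒L  : ∀ Γ γ φ ψ Δ →
         Common S one ((γ ∷ box⁻¹ Γ , one φ) ∷ (◇ γ ∷ ψ ∷ Γ , Δ) ∷ [])
                      (◇ γ ∷ (◇ φ ⇒ ψ) ∷ Γ , Δ)

SeqCK : Set
SeqCK = Seq Fm

data G4CK : List SeqCK → SeqCK → Set where
  common : ∀ {ps c} → Common Fm (λ φ → φ) ps c → G4CK ps c
  ◇L     : ∀ Γ φ ψ → G4CK ((φ ∷ box⁻¹ Γ , ψ) ∷ []) (◇ φ ∷ Γ , ◇ ψ)

SeqWK : Set
SeqWK = Seq (Maybe Fm)

dia⁻¹ : Maybe Fm → Maybe Fm
dia⁻¹ (just (◇ φ)) = just φ
dia⁻¹ _ = nothing

data G4WK : List SeqWK → SeqWK → Set where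
  common : ∀ {ps c} → Common (Maybe Fm) just ps c → G4WK ps c
  ◇L'    : ∀ Γ φ Δ → G4WK ((φ ∷ box⁻¹ Γ , dia⁻¹ Δ) ∷ []) (◇ φ ∷ Γ , Δ)

PremiseOf : {S : Set} → (List (Seq S) → Seq S → Set) → Seq S → Seq S → Set
PremiseOf {S} R s' s =
  Σ (List (Seq S)) λ ps → Σ (Seq S) λ c → R ps c × (s ≈ c) × Any (s' ≈_) ps

StronglyTerminates : {S : Set} → (List (Seq S) → Seq S → Set) → Set
StronglyTerminates {S} R =
  (f : ℕ → Seq S) → ((i : ℕ) → PremiseOf R (f (suc i)) (f i)) → Data.Empty.⊥

-- Measure a sequent by the total size of its formulas, a formula of weight w having
-- size 2 ^ w, where the weight counts each connective once except ∧, which counts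
-- twice (so that (φ ∧ ψ) ⇒ χ outweighs φ ⇒ (ψ ⇒ χ)).  Every rule replaces its
-- principal formula by at most two formulas of smaller weight, and
-- 2 ^ a + 2 ^ b < 2 ^ (n + 1) whenever a, b < n; otherwise the rules only shrink the
-- side formulas (box⁻¹ and dia⁻¹ strip a modality or drop the formula).  So every
-- premise is strictly lighter than its conclusion, the measure is invariant under
-- permuting the antecedent, and backward proof search is a descent in ℕ.
module Submission where

open import Defs
open import Data.Empty using () renaming (⊥ to Empty)
open import Data.List using (List; []; _∷_; _++_; map; fromMaybe)
open import Data.List.Properties using (map-++)
open import Data.List.Membership.Propositional using (_∈_; find)
open import Data.List.Relation.Unary.Any using (here; there)
open import Data.List.Relation.Binary.Permutation.Propositional using (_↭_; refl; swap)
open import Data.List.Relation.Binary.Permutation.Propositional.Properties using (map⁺; ++⁺ˡ)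
open import Data.Maybe using (just; nothing)
open import Data.Nat using (ℕ; suc; _+_; _^_; _≤_; _<_; z≤n; s≤s)
open import Data.Nat.Induction using (<-wellFounded)
open import Data.Nat.ListAction using (sum)
open import Data.Nat.ListAction.Properties using (sum-++; sum-↭)
open import Data.Nat.Properties
open import Data.Product using (_×_; _,_)
open import Function using (_∘_)
open import Induction.WellFounded using (WellFounded; Acc; acc)
open import Level using (Level)
open import Relation.Binary using (Rel)
open import Relation.Binary.PropositionalEquality using (_≡_; refl; sym; cong; subst; subst₂; module ≡-Reasoning)

module _ {a r : Level} {A : Set a} {_<ᴬ_ : Rel A r} where

  Descending : (ℕ → A) → Set r
  Descending f = ∀ i → f (suc i) <ᴬ f i

  acc⇒¬descending : ∀ f → Acc _<ᴬ_ (f 0) → Descending f → Empty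
  acc⇒¬descending f (acc rs) desc = acc⇒¬descending (f ∘ suc) (rs (desc 0)) (desc ∘ suc)

  no-infinite-descent : WellFounded _<ᴬ_ → ∀ f → Descending f → Empty
  no-infinite-descent wf f = acc⇒¬descending f (wf (f 0))

weight : Fm → ℕ
weight (var _) = 1
weight ⊥       = 1
weight (φ ∧ ψ) = suc (suc (weight φ + weight ψ))
weight (φ ∨ ψ) = suc (weight φ + weight ψ)
weight (φ ⇒ ψ) = suc (weight φ + weight ψ)
weight (□ φ)   = suc (weight φ)
weight (◇ φ)   = suc (weight φ)

0<weight : ∀ φ → 0 < weight φ
0<weight (var _) = s≤s z≤n
0<weight ⊥       = s≤s z≤n
0<weight (_ ∧ _) = s≤s z≤n
0<weight (_ ∨ _) = s≤s z≤n
0<weight (_ ⇒ _) = s≤s z≤n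
0<weight (□ _)   = s≤s z≤n
0<weight (◇ _)   = s≤s z≤n

size : Fm → ℕ
size φ = 2 ^ weight φ

2^-mono-< : ∀ {m n} → m < n → 2 ^ m < 2 ^ n
2^-mono-< = ^-monoʳ-< 2 (s≤s (s≤s z≤n))

2^-+-< : ∀ {m n k} → m < k → n < k → 2 ^ m + 2 ^ n < 2 ^ suc k
2^-+-< {k = k} m<k n<k = +-mono-< (2^-mono-< m<k) (<-≤-trans (2^-mono-< n<k) (m≤m+n (2 ^ k) 0))

‖_‖ : List Fm → ℕ
‖ Γ ‖ = sum (map size Γ)

‖‖-++ : ∀ Γ Δ → ‖ Γ ++ Δ ‖ ≡ ‖ Γ ‖ + ‖ Δ ‖
‖‖-++ Γ Δ rewrite map-++ size Γ Δ = sum-++ (map size Γ) (map size Δ)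

‖‖-↭ : ∀ {Γ Δ} → Γ ↭ Δ → ‖ Γ ‖ ≡ ‖ Δ ‖
‖‖-↭ = sum-↭ ∘ map⁺ size

-- Records rather than definitions, so that both lists can be inferred from a proof.
infix 4 _≼_ _≺_

record _≼_ (Γ Δ : List Fm) : Set where
  constructor mk≼
  field ‖‖-≤ : ‖ Γ ‖ ≤ ‖ Δ ‖

record _≺_ (Γ Δ : List Fm) : Set where
  constructor mk≺
  field ‖‖-< : ‖ Γ ‖ < ‖ Δ ‖

open _≺_

≼-refl : ∀ {Γ} → Γ ≼ Γ
≼-refl = mk≼ ≤-refl

≺⇒≼ : ∀ {Γ Δ} → Γ ≺ Δ → Γ ≼ Δ
≺⇒≼ (mk≺ p) = mk≼ (<⇒≤ p)

↭⇒≼ : ∀ {Γ Δ} → Γ ↭ Δ → Γ ≼ Δ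
↭⇒≼ p = mk≼ (≤-reflexive (‖‖-↭ p))

≼-trans : ∀ {Γ Δ Θ} → Γ ≼ Δ → Δ ≼ Θ → Γ ≼ Θ
≼-trans (mk≼ p) (mk≼ q) = mk≼ (≤-trans p q)

≺-trans : ∀ {Γ Δ Θ} → Γ ≺ Δ → Δ ≺ Θ → Γ ≺ Θ
≺-trans (mk≺ p) (mk≺ q) = mk≺ (<-trans p q)

≼-≺-trans : ∀ {Γ Δ Θ} → Γ ≼ Δ → Δ ≺ Θ → Γ ≺ Θ
≼-≺-trans (mk≼ p) (mk≺ q) = mk≺ (≤-<-trans p q)

≺-≼-trans : ∀ {Γ Δ Θ} → Γ ≺ Δ → Δ ≼ Θ → Γ ≺ Θ
≺-≼-trans (mk≺ p) (mk≼ q) = mk≺ (<-≤-trans p q)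

++-mono-≺-≼ : ∀ {Γ Γ' Δ Δ'} → Γ ≺ Γ' → Δ ≼ Δ' → Γ ++ Δ ≺ Γ' ++ Δ'
++-mono-≺-≼ {Γ} {Γ'} {Δ} {Δ'} (mk≺ p) (mk≼ q) =
  mk≺ (subst₂ _<_ (sym (‖‖-++ Γ Δ)) (sym (‖‖-++ Γ' Δ')) (+-mono-<-≤ p q))

++-mono-≼-≺ : ∀ {Γ Γ' Δ Δ'} → Γ ≼ Γ' → Δ ≺ Δ' → Γ ++ Δ ≺ Γ' ++ Δ'
++-mono-≼-≺ {Γ} {Γ'} {Δ} {Δ'} (mk≼ p) (mk≺ q) =
  mk≺ (subst₂ _<_ (sym (‖‖-++ Γ Δ)) (sym (‖‖-++ Γ' Δ')) (+-mono-≤-< p q))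

≼-++ˡ : ∀ Π {Γ} → Γ ≼ Π ++ Γ
≼-++ˡ Π {Γ} = mk≼ (subst (‖ Γ ‖ ≤_) (sym (‖‖-++ Π Γ)) (m≤n+m ‖ Γ ‖ ‖ Π ‖))

lighter-≺ : ∀ {φ ψ} → weight φ < weight ψ → φ ∷ [] ≺ ψ ∷ []
lighter-≺ p = mk≺ (+-monoˡ-< 0 (2^-mono-< p))

two-lighter-≺ : ∀ {φ ψ χ n} → weight φ < n → weight ψ < n → n < weight χ → φ ∷ ψ ∷ [] ≺ χ ∷ []
two-lighter-≺ {φ} {ψ} {χ} p q r =
  mk≺ (subst₂ _<_ (cong (size φ +_) (sym (+-identityʳ (size ψ)))) (sym (+-identityʳ (size χ)))
                  (<-≤-trans (2^-+-< p q) (^-monoʳ-≤ 2 r)))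

module _ {φ ψ : Fm} where

  private
    a = weight φ
    b = weight ψ

  ∧-≺ : φ ∷ ψ ∷ [] ≺ φ ∧ ψ ∷ []
  ∧-≺ = two-lighter-≺ (s≤s (m≤m+n a b)) (s≤s (m≤n+m b a)) ≤-refl

  ∧-≺ˡ : φ ∷ [] ≺ φ ∧ ψ ∷ []
  ∧-≺ˡ = lighter-≺ (m<n⇒m<1+n (s≤s (m≤m+n a b)))

  ∧-≺ʳ : ψ ∷ [] ≺ φ ∧ ψ ∷ []
  ∧-≺ʳ = lighter-≺ (m<n⇒m<1+n (s≤s (m≤n+m b a)))

  ∨-≺ˡ : φ ∷ [] ≺ φ ∨ ψ ∷ []
  ∨-≺ˡ = lighter-≺ (s≤s (m≤m+n a b))

  ∨-≺ʳ : ψ ∷ [] ≺ φ ∨ ψ ∷ []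
  ∨-≺ʳ = lighter-≺ (s≤s (m≤n+m b a))

  ⇒-≺ : ψ ∷ φ ∷ [] ≺ φ ⇒ ψ ∷ []
  ⇒-≺ = two-lighter-≺ (m<n+m b (0<weight φ)) (m<m+n a (0<weight ψ)) ≤-refl

  ⇒-≺ˡ : φ ∷ [] ≺ φ ⇒ ψ ∷ []
  ⇒-≺ˡ = lighter-≺ (s≤s (m≤m+n a b))

  ⇒-≺ʳ : ψ ∷ [] ≺ φ ⇒ ψ ∷ []
  ⇒-≺ʳ = lighter-≺ (s≤s (m≤n+m b a))

□-≺ : ∀ {φ} → φ ∷ [] ≺ □ φ ∷ []
□-≺ = lighter-≺ ≤-refl

◇-≺ : ∀ {φ} → φ ∷ [] ≺ ◇ φ ∷ []
◇-≺ = lighter-≺ ≤-refl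

module _ {φ ψ χ : Fm} where

  private
    a = weight φ
    b = weight ψ
    c = weight χ

  ∧⇒-≺ : φ ⇒ (ψ ⇒ χ) ∷ [] ≺ (φ ∧ ψ) ⇒ χ ∷ []
  ∧⇒-≺ = lighter-≺ (s≤s (s≤s (≤-reflexive (begin
    a + suc (b + c)   ≡⟨ +-suc a (b + c) ⟩
    suc (a + (b + c)) ≡⟨ cong suc (sym (+-assoc a b c)) ⟩
    suc (a + b + c)   ∎))))
    where open ≡-Reasoning

  ∨⇒-≺ : φ ⇒ χ ∷ ψ ⇒ χ ∷ [] ≺ (φ ∨ ψ) ⇒ χ ∷ []
  ∨⇒-≺ = two-lighter-≺ (s≤s (+-monoˡ-< c (m<m+n a (0<weight ψ))))
                       (s≤s (+-monoˡ-< c (m<n+m b (0<weight φ))))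
                       ≤-refl

  ⇒⇒-≺ : φ ⇒ ψ ∷ ψ ⇒ χ ∷ [] ≺ (φ ⇒ ψ) ⇒ χ ∷ []
  ⇒⇒-≺ = two-lighter-≺ (s≤s (m<m+n (a + b) (0<weight χ)))
                       (s≤s (+-monoˡ-< c (m<n+m b (0<weight φ))))
                       ≤-refl

box⁻¹-≼ : ∀ Γ → box⁻¹ Γ ≼ Γ
box⁻¹-≼ []            = ≼-refl
box⁻¹-≼ (□ φ ∷ Γ)     = ≺⇒≼ (++-mono-≺-≼ □-≺ (box⁻¹-≼ Γ))
box⁻¹-≼ (var p ∷ Γ)   = ≼-trans (box⁻¹-≼ Γ) (≼-++ˡ (var p ∷ []))
box⁻¹-≼ (⊥ ∷ Γ)       = ≼-trans (box⁻¹-≼ Γ) (≼-++ˡ (⊥ ∷ []))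
box⁻¹-≼ (φ ∧ ψ ∷ Γ)   = ≼-trans (box⁻¹-≼ Γ) (≼-++ˡ (φ ∧ ψ ∷ []))
box⁻¹-≼ (φ ∨ ψ ∷ Γ)   = ≼-trans (box⁻¹-≼ Γ) (≼-++ˡ (φ ∨ ψ ∷ []))
box⁻¹-≼ (φ ⇒ ψ ∷ Γ)   = ≼-trans (box⁻¹-≼ Γ) (≼-++ˡ (φ ⇒ ψ ∷ []))
box⁻¹-≼ (◇ φ ∷ Γ)     = ≼-trans (box⁻¹-≼ Γ) (≼-++ˡ (◇ φ ∷ []))

dia⁻¹-≼ : ∀ Δ → fromMaybe (dia⁻¹ Δ) ≼ fromMaybe Δ
dia⁻¹-≼ nothing          = ≼-refl
dia⁻¹-≼ (just (◇ φ))     = ≺⇒≼ ◇-≺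
dia⁻¹-≼ (just (var p))   = ≼-++ˡ (var p ∷ [])
dia⁻¹-≼ (just ⊥)         = ≼-++ˡ (⊥ ∷ [])
dia⁻¹-≼ (just (φ ∧ ψ))   = ≼-++ˡ (φ ∧ ψ ∷ [])
dia⁻¹-≼ (just (φ ∨ ψ))   = ≼-++ˡ (φ ∨ ψ ∷ [])
dia⁻¹-≼ (just (φ ⇒ ψ))   = ≼-++ˡ (φ ⇒ ψ ∷ [])
dia⁻¹-≼ (just (□ φ))     = ≼-++ˡ (□ φ ∷ [])

Rules : Set → Set₁
Rules S = List (Seq S) → Seq S → Set

module _ {S : Set} (⌊_⌋ : S → List Fm) where

  formulas : Seq S → List Fm
  formulas (Γ , Δ) = ⌊ Δ ⌋ ++ Γ

  ‖formulas‖-≈ : ∀ {s t} → s ≈ t → ‖ formulas s ‖ ≡ ‖ formulas t ‖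
  ‖formulas‖-≈ {_ , Δ} (Γ↭Γ' , refl) = ‖‖-↭ (++⁺ˡ ⌊ Δ ⌋ Γ↭Γ')

  Decreasing : Rules S → Set
  Decreasing R = ∀ {ps c p} → R ps c → p ∈ ps → formulas p ≺ formulas c

  premise-< : ∀ {R} → Decreasing R → ∀ {s' s} → PremiseOf R s' s → ‖ formulas s' ‖ < ‖ formulas s ‖
  premise-< dec {s'} {s} (ps , c , r , s≈c , s'≈ps) with find s'≈ps
  ... | p , p∈ps , s'≈p = begin-strict
    ‖ formulas s' ‖ ≡⟨ ‖formulas‖-≈ s'≈p ⟩
    ‖ formulas p ‖  <⟨ ‖‖-< (dec r p∈ps) ⟩
    ‖ formulas c ‖  ≡⟨ ‖formulas‖-≈ s≈c ⟨
    ‖ formulas s ‖  ∎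
    where open ≤-Reasoning

  decreasing⇒stronglyTerminates : ∀ {R} → Decreasing R → StronglyTerminates R
  decreasing⇒stronglyTerminates dec f premises =
    no-infinite-descent <-wellFounded (‖_‖ ∘ formulas ∘ f) (premise-< dec ∘ premises)

  common-decreasing : ∀ {one} → (∀ φ → ⌊ one φ ⌋ ≡ φ ∷ []) → Decreasing (Common S one)
  common-decreasing {one} ⌊one⌋ = go
    where
    principal : ∀ {xs ys} Δ Γ → xs ≺ ys → ⌊ Δ ⌋ ++ xs ++ Γ ≺ ⌊ Δ ⌋ ++ ys ++ Γ
    principal Δ Γ xs≺ys = ++-mono-≼-≺ (≼-refl {⌊ Δ ⌋}) (++-mono-≺-≼ xs≺ys (≼-refl {Γ}))

    go : Decreasing (Common S one)
    go (∧L Γ φ ψ Δ)     (here refl)         = principal Δ Γ ∧-≺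
    go (∧R Γ φ ψ)       (here refl)         rewrite ⌊one⌋ φ | ⌊one⌋ (φ ∧ ψ) = ++-mono-≺-≼ ∧-≺ˡ ≼-refl
    go (∧R Γ φ ψ)       (there (here refl)) rewrite ⌊one⌋ ψ | ⌊one⌋ (φ ∧ ψ) = ++-mono-≺-≼ ∧-≺ʳ ≼-refl
    go (∨L Γ φ ψ Δ)     (here refl)         = principal Δ Γ ∨-≺ˡ
    go (∨L Γ φ ψ Δ)     (there (here refl)) = principal Δ Γ ∨-≺ʳ
    go (∨R₁ Γ φ ψ)      (here refl)         rewrite ⌊one⌋ φ | ⌊one⌋ (φ ∨ ψ) = ++-mono-≺-≼ ∨-≺ˡ ≼-refl
    go (∨R₂ Γ φ ψ)      (here refl)         rewrite ⌊one⌋ ψ | ⌊one⌋ (φ ∨ ψ) = ++-mono-≺-≼ ∨-≺ʳ ≼-refl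
    go (⇒R Γ φ ψ)       (here refl)         rewrite ⌊one⌋ ψ | ⌊one⌋ (φ ⇒ ψ) = ++-mono-≺-≼ ⇒-≺ ≼-refl
    go (∧⇒L Γ φ ψ χ Δ)  (here refl)         = principal Δ Γ ∧⇒-≺
    go (∨⇒L Γ φ ψ χ Δ)  (here refl)         = principal Δ Γ ∨⇒-≺
    go (p⇒L Γ p φ Δ)    (here refl)         = principal Δ Γ (++-mono-≼-≺ (≼-refl {var p ∷ []}) ⇒-≺ʳ)
    go (⇒⇒L Γ φ ψ χ Δ)  (here refl)         rewrite ⌊one⌋ (φ ⇒ ψ) =
      ≺-≼-trans (++-mono-≺-≼ ⇒⇒-≺ ≼-refl) (≼-++ˡ ⌊ Δ ⌋)
    go (⇒⇒L Γ φ ψ χ Δ)  (there (here refl)) = principal Δ Γ ⇒-≺ʳ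
    go (□R Γ φ)         (here refl)         rewrite ⌊one⌋ φ | ⌊one⌋ (□ φ) = ++-mono-≺-≼ □-≺ (box⁻¹-≼ Γ)
    go (□⇒L Γ φ ψ Δ)    (here refl)         rewrite ⌊one⌋ φ =
      ≺-≼-trans (++-mono-≺-≼ (≺-trans □-≺ ⇒-≺ˡ) (box⁻¹-≼ Γ)) (≼-++ˡ ⌊ Δ ⌋)
    go (□⇒L Γ φ ψ Δ)    (there (here refl)) = principal Δ Γ ⇒-≺ʳ
    -- φ is charged to ◇ φ ⇒ ψ and γ to ◇ γ, so the two have to be swapped first.
    go (◇⇒L Γ γ φ ψ Δ)  (here refl)         rewrite ⌊one⌋ φ =
      ≼-≺-trans (↭⇒≼ (swap φ γ refl))
        (≺-≼-trans (++-mono-≺-≼ ◇-≺ (≺⇒≼ (++-mono-≺-≼ (≺-trans ◇-≺ ⇒-≺ˡ) (box⁻¹-≼ Γ))))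
                   (≼-++ˡ ⌊ Δ ⌋))
    go (◇⇒L Γ γ φ ψ Δ)  (there (here refl)) = principal Δ Γ (++-mono-≼-≺ (≼-refl {◇ γ ∷ []}) ⇒-≺ʳ)

G4CK-decreasing : Decreasing (_∷ []) G4CK
G4CK-decreasing (common r) p∈ps        = common-decreasing (_∷ []) (λ _ → refl) r p∈ps
G4CK-decreasing (◇L Γ φ ψ) (here refl) = ++-mono-≺-≼ ◇-≺ (≺⇒≼ (++-mono-≺-≼ ◇-≺ (box⁻¹-≼ Γ)))

G4WK-decreasing : Decreasing fromMaybe G4WK
G4WK-decreasing (common r)  p∈ps        = common-decreasing fromMaybe (λ _ → refl) r p∈ps
G4WK-decreasing (◇L' Γ φ Δ) (here refl) = ++-mono-≼-≺ (dia⁻¹-≼ Δ) (++-mono-≺-≼ ◇-≺ (box⁻¹-≼ Γ))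

proposition1 : StronglyTerminates G4CK × StronglyTerminates G4WK
proposition1 = decreasing⇒stronglyTerminates (_∷ []) G4CK-decreasing
             , decreasing⇒stronglyTerminates fromMaybe G4WK-decreasing
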